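{- Let $\mathbb{T}=(T,\eta,(-)^*)$ be a monad on a category $\mathbf{C}$ with finite coproducts and let $X\#Y=T(X+Y)$. (i) If $\mathbb{T}$ equipped with an operator $(-)^\dagger$ is a weak complete Elgot monad, then $\mathbf{C}^{\mathbb{T}}$ is isomorphic to the full subcategory of $\mathbf{CElg}_\#(\mathbf{C})$ formed by those complete Elgot $\#$-algebras $(A,a:T(A+A)\to A,(-)^\ddagger)$ for which $a$ factors through $T\nabla:T(A+A)\to TA$ and for which $e^\ddagger=a\circ T\mathsf{inl}\circ e^\dagger$ for every $e:X\to T(A+X)$. (ii) Conversely, suppose $J:\mathbf{C}^{\mathbb{T}}\to\mathbf{CElg}_\#(\mathbf{C})$ is a functor that sends each $\mathbb{T}$-algebra $a:TA\to A$ to a complete Elgot $\#$-algebra whose carrier is $A$ and whose $\#$-algebra structure is $a\circ T\nabla:T(A+A)\to A$, and is the identity on morphisms. Then $\mathbb{T}$ becomes a weak complete Elgot monad with the operator defined for $e:X\to T(Y+X)$ by \[e^\dagger=(T(\eta_Y+\mathrm{id}_X)\circ e)^\ddagger:X\to TY,\] where $(-)^\ddagger$ is the iteration operator of $J(TY,\mu_Y)$; moreover $J$ is then full and faithful.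
   Context: Monads are Kleisli triples with $Tf=(\eta\circ f)^*$, $\mu=\mathrm{id}^*$; $\nabla=[\mathrm{id},\mathrm{id}]$. $\mathbf{C}^{\mathbb{T}}$ is the category of Eilenberg–Moore $\mathbb{T}$-algebras. The parametrized monad $X\#Y=T(X+Y)$ has unit $u^Y_X=\eta\circ\mathsf{inl}$ and multiplication $m^Y_X=[\mathrm{id},\eta\circ\mathsf{inr}]^*:T(T(X+Y)+Y)\to T(X+Y)$. A $\#$-algebra is $(A,a)$, $a:A\#A\to A$, with $a\circ u^A_A=\mathrm{id}$, $a\circ(a\#\mathrm{id})=a\circ m^A_A$. A complete Elgot $\#$-algebra is a $\#$-algebra $(A,a)$ with an operator sending each $e:X\to A\#X$ to $e^\ddagger:X\to A$ such that: (solution) $e^\ddagger=a\circ(\mathrm{id}_A\#e^\ddagger)\circ e$; (functoriality) for $e:X\to A\#X$, $f:Y\to A\#Y$, $h:X\to Y$, if $f\circ h=(\mathrm{id}_A\#h)\circ e$ then $f^\ddagger\circ h=e^\ddagger$; (compositionality) for $f:Y\to A\#Y$, $g:X\to Y\#X$, with $f^\ddagger\bullet g=(f^\ddagger\#\mathrm{id}_X)\circ g$ and $f\blacksquare g=m^{Y+X}_A\circ(((\mathrm{id}_A\#\mathsf{inl})\circ f)\#\mathsf{inr})\circ[u^X_Y,g]$, $(f\blacksquare g)^\ddagger\circ\mathsf{inr}=(f^\ddagger\bullet g)^\ddagger$. $\mathbf{CElg}_\#(\mathbf{C})$ has as morphisms $(A,a,\ddagger)\to(B,b,\ddagger')$ those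 $f:A\to B$ with $((f\#\mathrm{id})\circ e)^{\ddagger'}=f\circ e^\ddagger$ for all $e$. A weak complete Elgot monad is a monad with an operator sending $f:X\to T(Y+X)$ to $f^\dagger:X\to TY$ satisfying: (fixpoint) $f^\dagger=[\eta_Y,f^\dagger]^*\circ f$; (naturality) for $g:Y\to TZ$, $g^*\circ f^\dagger=([T\mathsf{inl}\circ g,\eta\circ\mathsf{inr}]^*\circ f)^\dagger$; (uniformity) if $f\circ h=T(\mathrm{id}_Y+h)\circ g$ for $g:Z\to T(Y+Z)$, $h:Z\to X$, then $f^\dagger\circ h=g^\dagger$; and for all $g:X\to T(Y+X)$, $f:Y\to T(Z+Y)$, with $w=[T(\mathrm{id}_Z+\mathsf{inl})\circ f,\eta\circ\mathsf{inr}\circ\mathsf{inr}]^*\circ[\eta\circ\mathsf{inl},g]:Y+X\to T(Z+(Y+X))$, one has $w^\dagger\circ\mathsf{inr}=(f^\dagger)^*\circ g^\dagger$. -}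

module Defs where

open import Level using (Level; _⊔_) renaming (suc to lsuc)
open import Relation.Binary.PropositionalEquality using (_≡_; refl; sym; trans; cong; subst; subst₂)
open import Data.Product using (Σ; _×_; _,_; proj₁; proj₂)

record Category (o ℓ : Level) : Set (lsuc (o ⊔ ℓ)) where
  infixr 9 _∘_
  field
    Obj : Set o
    Hom : Obj → Obj → Set ℓ
    id  : ∀ {A} → Hom A A
    _∘_ : ∀ {A B C} → Hom B C → Hom A B → Hom A C
    identityˡ : ∀ {A B} {f : Hom A B} → id ∘ f ≡ f
    identityʳ : ∀ {A B} {f : Hom A B} → f ∘ id ≡ f
    assoc : ∀ {A B C D} {f : Hom A B} {g : Hom B C} {h : Hom C D} →
            (h ∘ g) ∘ f ≡ h ∘ (g ∘ f)

record FiniteCoproducts {o ℓ} (C : Category o ℓ) : Set (o ⊔ ℓ) where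
  open Category C
  infixr 6 _+_
  field
    𝟘 : Obj
    ¡ : ∀ {A} → Hom 𝟘 A
    ¡-unique : ∀ {A} (f : Hom 𝟘 A) → f ≡ ¡
    _+_ : Obj → Obj → Obj
    inl : ∀ {A B} → Hom A (A + B)
    inr : ∀ {A B} → Hom B (A + B)
    [_,_] : ∀ {A B C} → Hom A C → Hom B C → Hom (A + B) C
    inl-β : ∀ {A B C} {f : Hom A C} {g : Hom B C} → [ f , g ] ∘ inl ≡ f
    inr-β : ∀ {A B C} {f : Hom A C} {g : Hom B C} → [ f , g ] ∘ inr ≡ g
    []-unique : ∀ {A B C} {f : Hom A C} {g : Hom B C} {h : Hom (A + B) C} →
                h ∘ inl ≡ f → h ∘ inr ≡ g → h ≡ [ f , g ]

record KleisliTriple {o ℓ} (C : Category o ℓ) : Set (o ⊔ ℓ) where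
  open Category C
  infix 20 _*
  field
    T  : Obj → Obj
    η  : ∀ {A} → Hom A (T A)
    _* : ∀ {A B} → Hom A (T B) → Hom (T A) (T B)
    *-η : ∀ {A B} {f : Hom A (T B)} → f * ∘ η ≡ f
    η-* : ∀ {A} → η {A} * ≡ id
    *-∘ : ∀ {A B D} {f : Hom A (T B)} {g : Hom B (T D)} → (g * ∘ f) * ≡ g * ∘ f *

module Setting {o ℓ} (C : Category o ℓ) (cp : FiniteCoproducts C)
                (𝕋 : KleisliTriple C) where
  open Category C
  open FiniteCoproducts cp
  open KleisliTriple 𝕋

  T₁ : ∀ {A B} → Hom A B → Hom (T A) (T B)
  T₁ f = (η ∘ f) *

  μ : ∀ {A} → Hom (T (T A)) (T A)
  μ = id *

  infixr 7 _⊕_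
  _⊕_ : ∀ {A B A' B'} → Hom A A' → Hom B B' → Hom (A + B) (A' + B')
  f ⊕ g = [ inl ∘ f , inr ∘ g ]

  ∇ : ∀ {A} → Hom (A + A) A
  ∇ = [ id , id ]

  infixr 8 _#_ _#₁_
  _#_ : Obj → Obj → Obj
  X # Y = T (X + Y)

  _#₁_ : ∀ {X X' Y Y'} → Hom X X' → Hom Y Y' → Hom (X # Y) (X' # Y')
  f #₁ g = T₁ (f ⊕ g)

  u : ∀ X Y → Hom X (X # Y)
  u X Y = η ∘ inl

  m : ∀ X Y → Hom ((X # Y) # Y) (X # Y)
  m X Y = [ id , η ∘ inr ] *

  IterOp : Set (o ⊔ ℓ)
  IterOp = ∀ {X Y} → Hom X (T (Y + X)) → Hom X (T Y)

  record IsWeakCompleteElgot (_† : IterOp) : Set (o ⊔ ℓ) where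
    field
      fixpoint : ∀ {X Y} (f : Hom X (T (Y + X))) → f † ≡ [ η , f † ] * ∘ f
      naturality : ∀ {X Y Z} (f : Hom X (T (Y + X))) (g : Hom Y (T Z)) →
        g * ∘ f † ≡ ([ T₁ inl ∘ g , η ∘ inr ] * ∘ f) †
      uniformity : ∀ {X Y Z} (f : Hom X (T (Y + X))) (g : Hom Z (T (Y + Z)))
        (h : Hom Z X) → f ∘ h ≡ T₁ (id ⊕ h) ∘ g → f † ∘ h ≡ g †
      compositionality : ∀ {X Y Z} (g : Hom X (T (Y + X))) (f : Hom Y (T (Z + Y))) →
        let w : Hom (Y + X) (T (Z + (Y + X)))
            w = [ T₁ (id ⊕ inl) ∘ f , η ∘ inr ∘ inr ] * ∘ [ η ∘ inl , g ]
        in w † ∘ inr ≡ (f †) * ∘ g †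

  record EMAlg : Set (o ⊔ ℓ) where
    field
      carrier : Obj
      str : Hom (T carrier) carrier
      str-η : str ∘ η ≡ id
      str-μ : str ∘ μ ≡ str ∘ T₁ str
  open EMAlg public

  IsEMHom : (A B : EMAlg) → Hom (carrier A) (carrier B) → Set ℓ
  IsEMHom A B f = f ∘ str A ≡ str B ∘ T₁ f

  EMEq : EMAlg → EMAlg → Set (o ⊔ ℓ)
  EMEq A B = Σ (carrier A ≡ carrier B) λ p →
             subst (λ Z → Hom (T Z) Z) p (str A) ≡ str B

  record IsCompleteElgot (A : Obj) (a : Hom (A # A) A) : Set (o ⊔ ℓ) where
    infix 20 _‡
    field
      #-unit : a ∘ u A A ≡ id
      #-mult : a ∘ (a #₁ id) ≡ a ∘ m A A
      _‡ : ∀ {X} → Hom X (A # X) → Hom X A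
      solution : ∀ {X} (e : Hom X (A # X)) → e ‡ ≡ a ∘ (id #₁ e ‡) ∘ e
      functoriality : ∀ {X Y} (e : Hom X (A # X)) (f : Hom Y (A # Y))
        (h : Hom X Y) → f ∘ h ≡ (id #₁ h) ∘ e → f ‡ ∘ h ≡ e ‡
      compositionality : ∀ {X Y} (f : Hom Y (A # Y)) (g : Hom X (Y # X)) →
        let f•g : Hom X (A # X)
            f•g = ((f ‡) #₁ id) ∘ g
            f■g : Hom (Y + X) (A # (Y + X))
            f■g = m A (Y + X) ∘ (((id #₁ inl) ∘ f) #₁ inr) ∘ [ u Y X , g ]
        in (f■g ‡) ∘ inr ≡ f•g ‡

  record CElgAlg : Set (o ⊔ ℓ) where
    field
      ccarrier : Obj
      cstr : Hom (ccarrier # ccarrier) ccarrier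
      isCElg : IsCompleteElgot ccarrier cstr
  open CElgAlg public

  ‡of : (A : CElgAlg) → ∀ {X} → Hom X (ccarrier A # X) → Hom X (ccarrier A)
  ‡of A = IsCompleteElgot._‡ (isCElg A)

  IsCElgHom : (A B : CElgAlg) → Hom (ccarrier A) (ccarrier B) → Set (o ⊔ ℓ)
  IsCElgHom A B f = ∀ {X} (e : Hom X (ccarrier A # X)) →
    ‡of B ((f #₁ id) ∘ e) ≡ f ∘ ‡of A e

  CElgEq : CElgAlg → CElgAlg → Set (o ⊔ ℓ)
  CElgEq A B = Σ (ccarrier A ≡ ccarrier B) λ p →
    (subst (λ Z → Hom (Z # Z) Z) p (cstr A) ≡ cstr B) ×
    (∀ {X} (e : Hom X (ccarrier A # X)) →
       subst (Hom X) p (‡of A e) ≡ ‡of B (subst (λ Z → Hom X (Z # X)) p e))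

  -- Categories concrete over C (morphisms are C-morphisms with a property,
  -- equality of morphisms is equality of underlying C-morphisms)

  record ConcreteCat : Set (lsuc (o ⊔ ℓ)) where
    field
      Ob : Set (o ⊔ ℓ)
      ∣_∣ : Ob → Obj
      IsHom : (A B : Ob) → Hom ∣ A ∣ ∣ B ∣ → Set (o ⊔ ℓ)
      _≃_ : Ob → Ob → Set (o ⊔ ℓ)
      carrier≡ : ∀ {A B} → A ≃ B → ∣ A ∣ ≡ ∣ B ∣

    Mor : Ob → Ob → Set (o ⊔ ℓ)
    Mor A B = Σ (Hom ∣ A ∣ ∣ B ∣) (IsHom A B)

  EMCat : ConcreteCat
  EMCat = record
    { Ob = EMAlg ; ∣_∣ = carrier
    ; IsHom = λ A B f → Level.Lift (o ⊔ ℓ) (IsEMHom A B f)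
    ; _≃_ = EMEq ; carrier≡ = proj₁ }

  CElgSub : (P : CElgAlg → Set (o ⊔ ℓ)) → ConcreteCat
  CElgSub P = record
    { Ob = Σ CElgAlg P ; ∣_∣ = λ A → ccarrier (proj₁ A)
    ; IsHom = λ A B → IsCElgHom (proj₁ A) (proj₁ B)
    ; _≃_ = λ A B → CElgEq (proj₁ A) (proj₁ B) ; carrier≡ = proj₁ }

  record Functor (𝔸 𝔹 : ConcreteCat) : Set (o ⊔ ℓ) where
    private
      module 𝔸 = ConcreteCat 𝔸
      module 𝔹 = ConcreteCat 𝔹
    field
      F₀ : 𝔸.Ob → 𝔹.Ob
      F₁ : ∀ {A B} → 𝔸.Mor A B → 𝔹.Mor (F₀ A) (F₀ B)
      F-resp : ∀ {A B} (f g : 𝔸.Mor A B) → proj₁ f ≡ proj₁ g →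
               proj₁ (F₁ f) ≡ proj₁ (F₁ g)
      F-id : ∀ {A} (p : 𝔸.IsHom A A id) → proj₁ (F₁ {A} (id , p)) ≡ id
      F-∘ : ∀ {A B D} (f : 𝔸.Mor A B) (g : 𝔸.Mor B D)
            (p : 𝔸.IsHom A D (proj₁ g ∘ proj₁ f)) →
            proj₁ (F₁ (proj₁ g ∘ proj₁ f , p)) ≡ proj₁ (F₁ g) ∘ proj₁ (F₁ f)

  record Isomorphic (𝔸 𝔹 : ConcreteCat) : Set (o ⊔ ℓ) where
    private
      module 𝔸 = ConcreteCat 𝔸
      module 𝔹 = ConcreteCat 𝔹
    field
      F : Functor 𝔸 𝔹
      G : Functor 𝔹 𝔸
    open Functor F using (F₀; F₁)
    open Functor G renaming (F₀ to G₀; F₁ to G₁)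
    field
      GF₀ : ∀ A → G₀ (F₀ A) 𝔸.≃ A
      GF₁ : ∀ {A B} (f : 𝔸.Mor A B) →
        subst₂ Hom (𝔸.carrier≡ (GF₀ A)) (𝔸.carrier≡ (GF₀ B))
               (proj₁ (G₁ (F₁ f))) ≡ proj₁ f
      FG₀ : ∀ B → F₀ (G₀ B) 𝔹.≃ B
      FG₁ : ∀ {A B} (f : 𝔹.Mor A B) →
        subst₂ Hom (𝔹.carrier≡ (FG₀ A)) (𝔹.carrier≡ (FG₀ B))
               (proj₁ (F₁ (G₁ f))) ≡ proj₁ f

  SubPred : IterOp → CElgAlg → Set (o ⊔ ℓ)
  SubPred _† A =
    (Σ (Hom (T (ccarrier A)) (ccarrier A)) λ a' → cstr A ≡ a' ∘ T₁ ∇) ×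
    (∀ {X} (e : Hom X (T (ccarrier A + X))) →
       ‡of A e ≡ cstr A ∘ T₁ inl ∘ e †)

  StatementI : Set (o ⊔ ℓ)
  StatementI = (_† : IterOp) → IsWeakCompleteElgot _† →
               Isomorphic EMCat (CElgSub (SubPred _†))

  private
    μ-η : ∀ {A} → μ {A} ∘ η ≡ id
    μ-η = *-η

    μ-μ : ∀ {A} → μ {A} ∘ μ ≡ μ ∘ T₁ μ
    μ-μ = trans (sym *-∘)
          (trans (cong _* (trans identityʳ (sym (trans (sym assoc)
                   (trans (cong (_∘ id *) *-η) identityˡ)))))
                 *-∘)

  FreeAlg : Obj → EMAlg
  FreeAlg Y = record { carrier = T Y ; str = μ ; str-η = μ-η ; str-μ = μ-μ }

  -- A functor J : C^T → CElg_#(C) with J(A,a) = (A, a ∘ T∇, ...) which is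
  -- the identity on morphisms, given by its action on objects (the Elgot
  -- structure on (A, a ∘ T∇)) and the fact that every T-algebra morphism
  -- is a CElg_#-morphism.
  J₀ : (J : (A : EMAlg) → IsCompleteElgot (carrier A) (str A ∘ T₁ ∇)) →
       EMAlg → CElgAlg
  J₀ J A = record { ccarrier = carrier A ; cstr = str A ∘ T₁ ∇ ; isCElg = J A }

  inducedDagger : (J : (A : EMAlg) → IsCompleteElgot (carrier A) (str A ∘ T₁ ∇)) →
                  IterOp
  inducedDagger J {X} {Y} e = ‡of (J₀ J (FreeAlg Y)) (T₁ (η ⊕ id) ∘ e)

  StatementII : Set (o ⊔ ℓ)
  StatementII =
    (J : (A : EMAlg) → IsCompleteElgot (carrier A) (str A ∘ T₁ ∇)) →
    (J-mor : ∀ (A B : EMAlg) (f : Hom (carrier A) (carrier B)) →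
             IsEMHom A B f → IsCElgHom (J₀ J A) (J₀ J B) f) →
    IsWeakCompleteElgot (inducedDagger J) ×
    -- J full: every CElg-morphism J A → J B is J g for some T-algebra morphism g
    (∀ (A B : EMAlg) (f : Hom (carrier A) (carrier B)) →
       IsCElgHom (J₀ J A) (J₀ J B) f →
       Σ (Hom (carrier A) (carrier B)) λ g → IsEMHom A B g × g ≡ f) ×
    -- J faithful (J is the identity on morphisms)
    (∀ (A B : EMAlg) (g h : Hom (carrier A) (carrier B)) →
       IsEMHom A B g → IsEMHom A B h → g ≡ h → g ≡ h)

-- Every EM-algebra a : T A → A carries the #-algebra a ∘ T∇, iterated by
-- e ↦ a ∘ e†; the laws of a weak complete Elgot monad transfer verbatim to the
-- laws of a complete Elgot #-algebra, and conversely a member of the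
-- subcategory is recovered from a' = ‡(T inl), which satisfies the EM-laws
-- because (T inl)† = id.  In the other direction the Elgot monad laws for
-- e† = (T(η + id) ∘ e)‡ are the #-algebra laws of the free algebras (T Y, μ),
-- plus the fact that Kleisli extensions g* are EM-morphisms (T Y, μ) → (T Z, μ)
-- and are therefore preserved by J; this gives naturality and
-- compositionality.
module Submission where

open import Level using (Level; lift; lower)
open import Data.Product using (_×_; _,_; proj₁; proj₂; Σ)
open import Relation.Binary.PropositionalEquality
  using (_≡_; refl; sym; trans; cong; cong₂; module ≡-Reasoning)
open import Defs

module Theory {o ℓ : Level} (C : Category o ℓ) (cp : FiniteCoproducts C)
              (𝕋 : KleisliTriple C) where
  open Category C
  open FiniteCoproducts cp
  open KleisliTriple 𝕋
  open Setting C cp 𝕋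
  open ≡-Reasoning

  pullˡ : ∀ {A B D E} {g : Hom D E} {f : Hom B D} {h : Hom B E} {k : Hom A B} →
          g ∘ f ≡ h → g ∘ (f ∘ k) ≡ h ∘ k
  pullˡ {k = k} p = trans (sym assoc) (cong (_∘ k) p)

  ∘-[] : ∀ {A B D E} {f : Hom A D} {g : Hom B D} {h : Hom D E} →
         h ∘ [ f , g ] ≡ [ h ∘ f , h ∘ g ]
  ∘-[] {h = h} = []-unique (trans assoc (cong (h ∘_) inl-β))
                           (trans assoc (cong (h ∘_) inr-β))

  []∘⊕ : ∀ {A B A' B' D} {f : Hom A' D} {g : Hom B' D} {h : Hom A A'} {k : Hom B B'} →
         [ f , g ] ∘ (h ⊕ k) ≡ [ f ∘ h , g ∘ k ]
  []∘⊕ = trans ∘-[] (cong₂ [_,_] (pullˡ inl-β) (pullˡ inr-β))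

  ⊕∘⊕ : ∀ {A B A' B' A'' B''} {f : Hom A' A''} {g : Hom B' B''}
          {h : Hom A A'} {k : Hom B B'} →
        (f ⊕ g) ∘ (h ⊕ k) ≡ (f ∘ h) ⊕ (g ∘ k)
  ⊕∘⊕ = trans []∘⊕ (cong₂ [_,_] assoc assoc)

  ∇∘⊕ : ∀ {A B D} {f : Hom A D} {g : Hom B D} → ∇ ∘ (f ⊕ g) ≡ [ f , g ]
  ∇∘⊕ = trans []∘⊕ (cong₂ [_,_] identityˡ identityˡ)

  ⊕-interchange : ∀ {A B A' B'} {f : Hom A A'} {g : Hom B B'} →
                  (f ⊕ id) ∘ (id ⊕ g) ≡ (id ⊕ g) ∘ (f ⊕ id)
  ⊕-interchange = trans ⊕∘⊕
    (trans (cong₂ _⊕_ (trans identityʳ (sym identityˡ))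
                      (trans identityˡ (sym identityʳ)))
           (sym ⊕∘⊕))

  T₁∘* : ∀ {A B D} {g : Hom B D} {f : Hom A (T B)} → T₁ g ∘ f * ≡ (T₁ g ∘ f) *
  T₁∘* = sym *-∘

  *∘T₁ : ∀ {A B D} {g : Hom B (T D)} {f : Hom A B} → g * ∘ T₁ f ≡ (g ∘ f) *
  *∘T₁ = trans (sym *-∘) (cong _* (pullˡ *-η))

  T₁-∘ : ∀ {A B D} {g : Hom B D} {f : Hom A B} → T₁ (g ∘ f) ≡ T₁ g ∘ T₁ f
  T₁-∘ = sym (trans *∘T₁ (cong _* assoc))

  T₁-id : ∀ {A} → T₁ (id {A}) ≡ id
  T₁-id = trans (cong _* identityʳ) η-*

  T₁-∘-∘ : ∀ {A B D E} {g : Hom D E} {f : Hom B D} {k : Hom A (T B)} →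
           T₁ g ∘ (T₁ f ∘ k) ≡ T₁ (g ∘ f) ∘ k
  T₁-∘-∘ = pullˡ (sym T₁-∘)

  μ∘T₁ : ∀ {A B} {h : Hom A (T B)} → μ ∘ T₁ h ≡ h *
  μ∘T₁ = trans *∘T₁ (cong _* identityˡ)

  T₁∘η : ∀ {A B D} {f : Hom B D} {g : Hom A B} → T₁ f ∘ (η ∘ g) ≡ η ∘ (f ∘ g)
  T₁∘η = trans (pullˡ *-η) assoc

  T₁∇∘T₁inl : ∀ {A} → T₁ ∇ ∘ T₁ (inl {A} {A}) ≡ id
  T₁∇∘T₁inl = trans (sym T₁-∘) (trans (cong T₁ inl-β) T₁-id)

  T₁∇∘η∘inl : ∀ {A} → T₁ ∇ ∘ (η ∘ inl {A} {A}) ≡ η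
  T₁∇∘η∘inl = trans T₁∘η (trans (cong (η ∘_) inl-β) identityʳ)

  T₁∇∘η∘inr : ∀ {A} → T₁ ∇ ∘ (η ∘ inr {A} {A}) ≡ η
  T₁∇∘η∘inr = trans T₁∘η (trans (cong (η ∘_) inr-β) identityʳ)

  cancel-T₁∇∘T₁inl : ∀ {A B X} {x : Hom (T A) B} {h : Hom X (T A)} →
                     (x ∘ T₁ ∇) ∘ (T₁ inl ∘ h) ≡ x ∘ h
  cancel-T₁∇∘T₁inl {x = x} =
    trans assoc (cong (x ∘_) (trans (pullˡ T₁∇∘T₁inl) identityˡ))

  T₁⊕∘T₁inl : ∀ {A B A' B'} {f : Hom A A'} {g : Hom B B'} →
              T₁ (f ⊕ g) ∘ T₁ inl ≡ T₁ inl ∘ T₁ f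
  T₁⊕∘T₁inl = trans (sym T₁-∘) (trans (cong T₁ inl-β) T₁-∘)

  η∘⊕id : ∀ {Y Z X} {d : Hom Y Z} →
          η ∘ (d ⊕ id {X}) ≡ [ T₁ inl ∘ (η ∘ d) , η ∘ inr ]
  η∘⊕id = trans ∘-[] (sym (cong₂ [_,_] T₁∘η (cong (η ∘_) (sym identityʳ))))

  -- The loops of the two compositionality laws (feedback f g is the w of the monad law)

  _■_ : ∀ {A X Y} → Hom Y (A # Y) → Hom X (Y # X) → Hom (Y + X) (A # (Y + X))
  _■_ {A} {X} {Y} f g = m A (Y + X) ∘ (((id #₁ inl) ∘ f) #₁ inr) ∘ [ u Y X , g ]

  feedback : ∀ {X Y Z} → Hom Y (T (Z + Y)) → Hom X (T (Y + X)) →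
             Hom (Y + X) (T (Z + (Y + X)))
  feedback f g = [ T₁ (id ⊕ inl) ∘ f , η ∘ inr ∘ inr ] * ∘ [ η ∘ inl , g ]

  ■≡feedback : ∀ {A X Y} (f : Hom Y (A # Y)) (g : Hom X (Y # X)) →
               f ■ g ≡ feedback f g
  ■≡feedback f g = pullˡ
    (trans *∘T₁ (cong _* (trans []∘⊕ (cong₂ [_,_] identityˡ assoc))))

  feedback∘inr : ∀ {X Y Z} (f : Hom Y (T (Z + Y))) (g : Hom X (T (Y + X))) →
                 feedback f g ∘ inr ≡ [ T₁ (id ⊕ inl) ∘ f , η ∘ inr ∘ inr ] * ∘ g
  feedback∘inr f g = trans assoc (cong (_ ∘_) inr-β)

  str∘* : (A : EMAlg) → ∀ {X} {g : Hom X (T (carrier A))} →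
          str A ∘ g * ≡ str A ∘ T₁ (str A ∘ g)
  str∘* A {g = g} = begin
    str A ∘ g *                  ≡⟨ cong (str A ∘_) (sym μ∘T₁) ⟩
    str A ∘ (μ ∘ T₁ g)           ≡⟨ pullˡ (str-μ A) ⟩
    (str A ∘ T₁ (str A)) ∘ T₁ g  ≡⟨ assoc ⟩
    str A ∘ (T₁ (str A) ∘ T₁ g)  ≡⟨ cong (str A ∘_) (sym T₁-∘) ⟩
    str A ∘ T₁ (str A ∘ g)       ∎

  *-isEMHom : ∀ {Y Z} (h : Hom Y (T Z)) → IsEMHom (FreeAlg Y) (FreeAlg Z) (h *)
  *-isEMHom h = trans (sym *-∘) (trans (cong _* identityʳ) (sym μ∘T₁))

  isCElgHom⇒T-action-hom :
    (A B : CElgAlg) {a : Hom (T (ccarrier A)) (ccarrier A)} {b : Hom (T (ccarrier B)) (ccarrier B)} →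
    (∀ {Y} {g : Hom Y (T (ccarrier A))} → ‡of A (T₁ inl ∘ g) ≡ a ∘ g) →
    (∀ {Y} {g : Hom Y (T (ccarrier B))} → ‡of B (T₁ inl ∘ g) ≡ b ∘ g) →
    (f : Hom (ccarrier A) (ccarrier B)) → IsCElgHom A B f → f ∘ a ≡ b ∘ T₁ f
  isCElgHom⇒T-action-hom A B {a} {b} ‡ᴬ-T₁inl ‡ᴮ-T₁inl f h = begin
    f ∘ a                                   ≡⟨ cong (f ∘_) (sym (trans ‡ᴬ-T₁inl identityʳ)) ⟩
    f ∘ ‡of A (T₁ inl ∘ id)                 ≡⟨ sym (h _) ⟩
    ‡of B (T₁ (f ⊕ id) ∘ (T₁ inl ∘ id))     ≡⟨ cong (‡of B) (pullˡ T₁⊕∘T₁inl) ⟩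
    ‡of B ((T₁ inl ∘ T₁ f) ∘ id)            ≡⟨ trans (cong (‡of B) assoc) ‡ᴮ-T₁inl ⟩
    b ∘ (T₁ f ∘ id)                         ≡⟨ cong (b ∘_) identityʳ ⟩
    b ∘ T₁ f                                ∎

  module FromElgotMonad (_† : IterOp) (W : IsWeakCompleteElgot _†) where
    open IsWeakCompleteElgot W renaming (compositionality to †-compositionality)

    †-T₁inl : ∀ {X Y} {g : Hom X (T Y)} → (T₁ inl ∘ g) † ≡ g
    †-T₁inl {g = g} = begin
      (T₁ inl ∘ g) †                            ≡⟨ fixpoint _ ⟩
      [ η , (T₁ inl ∘ g) † ] * ∘ (T₁ inl ∘ g)   ≡⟨ pullˡ *∘T₁ ⟩
      ([ η , (T₁ inl ∘ g) † ] ∘ inl) * ∘ g      ≡⟨ cong (λ z → z * ∘ g) inl-β ⟩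
      η * ∘ g                                   ≡⟨ cong (_∘ g) η-* ⟩
      id ∘ g                                    ≡⟨ identityˡ ⟩
      g                                         ∎

    T₁∘† : ∀ {X Y Z} {d : Hom Y Z} {e : Hom X (T (Y + X))} →
           T₁ d ∘ e † ≡ (T₁ (d ⊕ id) ∘ e) †
    T₁∘† {d = d} {e} =
      trans (naturality e (η ∘ d)) (cong (λ z → (z * ∘ e) †) (sym η∘⊕id))

    module EMElgot (A : EMAlg) where
      a : Hom (T (carrier A)) (carrier A)
      a = str A

      α : Hom (carrier A # carrier A) (carrier A)
      α = a ∘ T₁ ∇

      iterate : ∀ {X} → Hom X (carrier A # X) → Hom X (carrier A)
      iterate e = α ∘ T₁ inl ∘ e †

      iterate≡ : ∀ {X} (e : Hom X (carrier A # X)) → iterate e ≡ a ∘ e †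
      iterate≡ e = cancel-T₁∇∘T₁inl

      #-unit : α ∘ u (carrier A) (carrier A) ≡ id
      #-unit = trans assoc (trans (cong (a ∘_) T₁∇∘η∘inl) (str-η A))

      #-mult : α ∘ (α #₁ id) ≡ α ∘ m (carrier A) (carrier A)
      #-mult = begin
        α ∘ (α #₁ id)                    ≡⟨ trans assoc (cong (a ∘_) (sym T₁-∘)) ⟩
        a ∘ T₁ (∇ ∘ (α ⊕ id))            ≡⟨ cong (λ z → a ∘ T₁ z) ∇∘⊕ ⟩
        a ∘ T₁ [ α , id ]                ≡⟨ cong (λ z → a ∘ T₁ z)
                                              (sym (trans ∘-[] (cong₂ [_,_] refl (str-η A)))) ⟩
        a ∘ T₁ (a ∘ [ T₁ ∇ , η ])         ≡⟨ sym (str∘* A) ⟩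
        a ∘ [ T₁ ∇ , η ] *               ≡⟨ cong (λ z → a ∘ z *)
                                              (sym (trans ∘-[] (cong₂ [_,_] identityʳ T₁∇∘η∘inr))) ⟩
        a ∘ (T₁ ∇ ∘ [ id , η ∘ inr ]) *   ≡⟨ cong (a ∘_) (sym T₁∘*) ⟩
        a ∘ (T₁ ∇ ∘ [ id , η ∘ inr ] *)   ≡⟨ sym assoc ⟩
        α ∘ m (carrier A) (carrier A)    ∎

      solution : ∀ {X} (e : Hom X (carrier A # X)) →
                 iterate e ≡ α ∘ (id #₁ iterate e) ∘ e
      solution e = begin
        iterate e                          ≡⟨ iterate≡ e ⟩
        a ∘ e †                            ≡⟨ cong (a ∘_) (fixpoint e) ⟩
        a ∘ ([ η , e † ] * ∘ e)            ≡⟨ sym assoc ⟩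
        (a ∘ [ η , e † ] *) ∘ e            ≡⟨ cong (_∘ e) (str∘* A) ⟩
        (a ∘ T₁ (a ∘ [ η , e † ])) ∘ e     ≡⟨ cong (λ z → (a ∘ T₁ z) ∘ e)
                                                (trans ∘-[] (cong₂ [_,_] (str-η A) (sym (iterate≡ e)))) ⟩
        (a ∘ T₁ [ id , iterate e ]) ∘ e    ≡⟨ cong (λ z → (a ∘ T₁ z) ∘ e) (sym ∇∘⊕) ⟩
        (a ∘ T₁ (∇ ∘ (id ⊕ iterate e))) ∘ e ≡⟨ cong (λ z → (a ∘ z) ∘ e) T₁-∘ ⟩
        (a ∘ (T₁ ∇ ∘ (id #₁ iterate e))) ∘ e ≡⟨ trans (cong (_∘ e) (sym assoc)) assoc ⟩
        α ∘ (id #₁ iterate e) ∘ e          ∎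

      functoriality : ∀ {X Y} (e : Hom X (carrier A # X)) (f : Hom Y (carrier A # Y))
                      (h : Hom X Y) → f ∘ h ≡ (id #₁ h) ∘ e → iterate f ∘ h ≡ iterate e
      functoriality e f h p = begin
        iterate f ∘ h   ≡⟨ cong (_∘ h) (iterate≡ f) ⟩
        (a ∘ f †) ∘ h   ≡⟨ trans assoc (cong (a ∘_) (uniformity f e h p)) ⟩
        a ∘ e †         ≡⟨ sym (iterate≡ e) ⟩
        iterate e       ∎

      compositionality : ∀ {X Y} (f : Hom Y (carrier A # Y)) (g : Hom X (Y # X)) →
                         iterate (f ■ g) ∘ inr ≡ iterate ((iterate f #₁ id) ∘ g)
      compositionality f g = begin
        iterate (f ■ g) ∘ inr           ≡⟨ cong (λ z → iterate z ∘ inr) (■≡feedback f g) ⟩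
        iterate (feedback f g) ∘ inr    ≡⟨ cong (_∘ inr) (iterate≡ _) ⟩
        (a ∘ feedback f g †) ∘ inr      ≡⟨ trans assoc (cong (a ∘_) (†-compositionality g f)) ⟩
        a ∘ (f † * ∘ g †)               ≡⟨ sym assoc ⟩
        (a ∘ f † *) ∘ g †               ≡⟨ cong (_∘ g †) (str∘* A) ⟩
        (a ∘ T₁ (a ∘ f †)) ∘ g †        ≡⟨ trans assoc (cong (a ∘_) T₁∘†) ⟩
        a ∘ (T₁ ((a ∘ f †) ⊕ id) ∘ g) † ≡⟨ cong (λ z → a ∘ (T₁ (z ⊕ id) ∘ g) †)
                                                (sym (iterate≡ f)) ⟩
        a ∘ ((iterate f #₁ id) ∘ g) †   ≡⟨ sym (iterate≡ _) ⟩
        iterate ((iterate f #₁ id) ∘ g) ∎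

      isCompleteElgot : IsCompleteElgot (carrier A) α
      isCompleteElgot = record
        { #-unit = #-unit ; #-mult = #-mult ; _‡ = iterate ; solution = solution
        ; functoriality = functoriality ; compositionality = compositionality }

    emToElgot : EMAlg → Σ CElgAlg (SubPred _†)
    emToElgot A =
      record { ccarrier = carrier A ; cstr = str A ∘ T₁ ∇
             ; isCElg = EMElgot.isCompleteElgot A } ,
      (str A , refl) , (λ e → refl)

    isEMHom⇒isCElgHom : ∀ (A B : EMAlg) (f : Hom (carrier A) (carrier B)) → IsEMHom A B f →
                        IsCElgHom (proj₁ (emToElgot A)) (proj₁ (emToElgot B)) f
    isEMHom⇒isCElgHom A B f p e = begin
      B.iterate ((f #₁ id) ∘ e)     ≡⟨ B.iterate≡ _ ⟩
      str B ∘ (T₁ (f ⊕ id) ∘ e) †   ≡⟨ cong (str B ∘_) (sym T₁∘†) ⟩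
      str B ∘ (T₁ f ∘ e †)          ≡⟨ pullˡ (sym p) ⟩
      (f ∘ str A) ∘ e †             ≡⟨ trans assoc (cong (f ∘_) (sym (A.iterate≡ e))) ⟩
      f ∘ A.iterate e               ∎
      where
      module A = EMElgot A
      module B = EMElgot B

    module ElgotToEM (B : Σ CElgAlg (SubPred _†)) where
      open CElgAlg (proj₁ B) renaming (ccarrier to X; cstr to b; isCElg to b-isCElg)
      open IsCompleteElgot b-isCElg using (_‡; #-unit; #-mult)

      a : Hom (T X) X
      a = proj₁ (proj₁ (proj₂ B))

      b≡a∘T₁∇ : b ≡ a ∘ T₁ ∇
      b≡a∘T₁∇ = proj₂ (proj₁ (proj₂ B))

      ‡≡ : ∀ {Y} (e : Hom Y (T (X + Y))) → e ‡ ≡ b ∘ T₁ inl ∘ e †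
      ‡≡ = proj₂ (proj₂ B)

      b∘T₁inl : b ∘ T₁ inl ≡ a
      b∘T₁inl = trans (cong (_∘ T₁ inl) b≡a∘T₁∇)
                      (trans assoc (trans (cong (a ∘_) T₁∇∘T₁inl) identityʳ))

      a-η : a ∘ η ≡ id
      a-η = begin
        a ∘ η                    ≡⟨ cong (a ∘_) (sym T₁∇∘η∘inl) ⟩
        a ∘ (T₁ ∇ ∘ (η ∘ inl))   ≡⟨ pullˡ (sym b≡a∘T₁∇) ⟩
        b ∘ u X X                ≡⟨ #-unit ⟩
        id                       ∎

      -- Restricting the #-multiplication law along k yields the EM-law for a.
      a-μ : a ∘ μ ≡ a ∘ T₁ a
      a-μ = begin
        a ∘ μ                    ≡⟨ sym b∘m∘k ⟩
        (b ∘ m X X) ∘ k          ≡⟨ cong (_∘ k) (sym #-mult) ⟩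
        (b ∘ (b #₁ id)) ∘ k      ≡⟨ b∘b#id∘k ⟩
        a ∘ T₁ a                 ∎
        where
        k : Hom (T (T X)) (T (T (X + X) + X))
        k = T₁ (inl ∘ T₁ inl)

        b∘m∘k : (b ∘ m X X) ∘ k ≡ a ∘ μ
        b∘m∘k = begin
          (b ∘ m X X) ∘ k                   ≡⟨ trans assoc (cong (b ∘_) *∘T₁) ⟩
          b ∘ ([ id , η ∘ inr ] ∘ (inl ∘ T₁ inl)) *
            ≡⟨ cong (λ z → b ∘ z *) (trans (pullˡ inl-β) identityˡ) ⟩
          b ∘ (T₁ inl) *                    ≡⟨ cong (_∘ (T₁ inl) *) b≡a∘T₁∇ ⟩
          (a ∘ T₁ ∇) ∘ (T₁ inl) *           ≡⟨ trans assoc (cong (a ∘_) T₁∘*) ⟩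
          a ∘ (T₁ ∇ ∘ T₁ inl) *             ≡⟨ cong (λ z → a ∘ z *) T₁∇∘T₁inl ⟩
          a ∘ μ                             ∎

        b∘b#id∘k : (b ∘ (b #₁ id)) ∘ k ≡ a ∘ T₁ a
        b∘b#id∘k = begin
          (b ∘ (b #₁ id)) ∘ k                  ≡⟨ trans assoc (cong (b ∘_) (sym T₁-∘)) ⟩
          b ∘ T₁ ((b ⊕ id) ∘ (inl ∘ T₁ inl))
            ≡⟨ cong (λ z → b ∘ T₁ z) (trans (pullˡ inl-β) assoc) ⟩
          b ∘ T₁ (inl ∘ (b ∘ T₁ inl))          ≡⟨ cong (λ z → b ∘ T₁ (inl ∘ z)) b∘T₁inl ⟩
          b ∘ T₁ (inl ∘ a)                     ≡⟨ cong₂ _∘_ b≡a∘T₁∇ T₁-∘ ⟩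
          (a ∘ T₁ ∇) ∘ (T₁ inl ∘ T₁ a)         ≡⟨ cancel-T₁∇∘T₁inl ⟩
          a ∘ T₁ a                             ∎

      emAlg : EMAlg
      emAlg = record { carrier = X ; str = a ; str-η = a-η ; str-μ = a-μ }

      ‡-T₁inl : ∀ {Y} {g : Hom Y (T X)} → (T₁ inl ∘ g) ‡ ≡ a ∘ g
      ‡-T₁inl {g = g} = begin
        (T₁ inl ∘ g) ‡                     ≡⟨ ‡≡ _ ⟩
        b ∘ T₁ inl ∘ (T₁ inl ∘ g) †        ≡⟨ pullˡ b∘T₁inl ⟩
        a ∘ (T₁ inl ∘ g) †                 ≡⟨ cong (a ∘_) †-T₁inl ⟩
        a ∘ g                              ∎

    isCElgHom⇒isEMHom : ∀ (A B : Σ CElgAlg (SubPred _†))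
                        (f : Hom (ccarrier (proj₁ A)) (ccarrier (proj₁ B))) →
                        IsCElgHom (proj₁ A) (proj₁ B) f →
                        IsEMHom (ElgotToEM.emAlg A) (ElgotToEM.emAlg B) f
    isCElgHom⇒isEMHom A B =
      isCElgHom⇒T-action-hom (proj₁ A) (proj₁ B) (ElgotToEM.‡-T₁inl A) (ElgotToEM.‡-T₁inl B)

    emAlg≅elgotSub : Isomorphic EMCat (CElgSub (SubPred _†))
    emAlg≅elgotSub = record
      { F = record
          { F₀ = emToElgot
          ; F₁ = λ {A} {B} f → proj₁ f , isEMHom⇒isCElgHom A B (proj₁ f) (lower (proj₂ f))
          ; F-resp = λ _ _ p → p ; F-id = λ _ → refl ; F-∘ = λ _ _ _ → refl }
      ; G = record
          { F₀ = ElgotToEM.emAlg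
          ; F₁ = λ {A} {B} f → proj₁ f , lift (isCElgHom⇒isEMHom A B (proj₁ f) (proj₂ f))
          ; F-resp = λ _ _ p → p ; F-id = λ _ → refl ; F-∘ = λ _ _ _ → refl }
      ; GF₀ = λ A → refl , refl
      ; GF₁ = λ _ → refl
      ; FG₀ = λ B → let open ElgotToEM B in
          refl , sym b≡a∘T₁∇ ,
          λ e → trans (cong (λ z → z ∘ T₁ inl ∘ e †) (sym b≡a∘T₁∇)) (sym (‡≡ e))
      ; FG₁ = λ _ → refl
      }

  module FromElgotFunctor
    (J : (A : EMAlg) → IsCompleteElgot (carrier A) (str A ∘ T₁ ∇))
    (J-mor : ∀ (A B : EMAlg) (f : Hom (carrier A) (carrier B)) →
             IsEMHom A B f → IsCElgHom (J₀ J A) (J₀ J B) f) where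

    _† : IterOp
    _† = inducedDagger J

    free‡ : ∀ Y {X} → Hom X (T (T Y + X)) → Hom X (T Y)
    free‡ Y = ‡of (J₀ J (FreeAlg Y))

    module JFree (Y : Obj) = IsCompleteElgot (J (FreeAlg Y))

    ‡-T₁inl : (A : EMAlg) → ∀ {X} {g : Hom X (T (carrier A))} →
              ‡of (J₀ J A) (T₁ inl ∘ g) ≡ str A ∘ g
    ‡-T₁inl A {g = g} = begin
      s                                    ≡⟨ IsCompleteElgot.solution (J A) _ ⟩
      α ∘ (T₁ (id ⊕ s) ∘ (T₁ inl ∘ g))     ≡⟨ cong (α ∘_) (pullˡ T₁⊕∘T₁inl) ⟩
      α ∘ ((T₁ inl ∘ T₁ id) ∘ g)           ≡⟨ cong (λ z → α ∘ (z ∘ g))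
                                                (trans (cong (T₁ inl ∘_) T₁-id) identityʳ) ⟩
      α ∘ (T₁ inl ∘ g)                     ≡⟨ cancel-T₁∇∘T₁inl ⟩
      str A ∘ g                            ∎
      where
      α = str A ∘ T₁ ∇
      s = ‡of (J₀ J A) (T₁ inl ∘ g)

    J-full : ∀ (A B : EMAlg) (f : Hom (carrier A) (carrier B)) →
             IsCElgHom (J₀ J A) (J₀ J B) f → IsEMHom A B f
    J-full A B = isCElgHom⇒T-action-hom (J₀ J A) (J₀ J B) (‡-T₁inl A) (‡-T₁inl B)

    ‡-T₁⟨inl∘η⟩ : ∀ {Y Z} {g : Hom Y (T Z)} → free‡ Z (T₁ (inl ∘ η) ∘ g) ≡ g
    ‡-T₁⟨inl∘η⟩ {g = g} = begin
      free‡ _ (T₁ (inl ∘ η) ∘ g)      ≡⟨ cong (λ z → free‡ _ (z ∘ g)) T₁-∘ ⟩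
      free‡ _ ((T₁ inl ∘ T₁ η) ∘ g)   ≡⟨ trans (cong (free‡ _) assoc) (‡-T₁inl (FreeAlg _)) ⟩
      μ ∘ (T₁ η ∘ g)                  ≡⟨ pullˡ μ∘T₁ ⟩
      η * ∘ g                         ≡⟨ trans (cong (_∘ g) η-*) identityˡ ⟩
      g                               ∎

    -- J preserves iteration along the EM-morphism h* : (T Y, μ) → (T Z, μ).
    *∘† : ∀ {X Y Z} (h : Hom Y (T Z)) (g : Hom X (T (Y + X))) →
          h * ∘ g † ≡ free‡ Z (T₁ (h ⊕ id) ∘ g)
    *∘† h g = begin
      h * ∘ g †
        ≡⟨ sym (J-mor (FreeAlg _) (FreeAlg _) (h *) (*-isEMHom h) _) ⟩
      free‡ _ (T₁ (h * ⊕ id) ∘ (T₁ (η ⊕ id) ∘ g)) ≡⟨ cong (free‡ _) (T₁-∘-∘) ⟩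
      free‡ _ (T₁ ((h * ⊕ id) ∘ (η ⊕ id)) ∘ g)    ≡⟨ cong (λ z → free‡ _ (T₁ z ∘ g))
                                                       (trans ⊕∘⊕ (cong₂ _⊕_ *-η identityˡ)) ⟩
      free‡ _ (T₁ (h ⊕ id) ∘ g)                   ∎

    fixpoint : ∀ {X Y} (f : Hom X (T (Y + X))) → f † ≡ [ η , f † ] * ∘ f
    fixpoint f = begin
      f †                                                   ≡⟨ JFree.solution _ _ ⟩
      (μ ∘ T₁ ∇) ∘ (T₁ (id ⊕ f †) ∘ (T₁ (η ⊕ id) ∘ f))      ≡⟨ cong ((μ ∘ T₁ ∇) ∘_) T₁-∘-∘ ⟩
      (μ ∘ T₁ ∇) ∘ (T₁ ((id ⊕ f †) ∘ (η ⊕ id)) ∘ f)         ≡⟨ trans assoc (cong (μ ∘_) T₁-∘-∘) ⟩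
      μ ∘ (T₁ (∇ ∘ ((id ⊕ f †) ∘ (η ⊕ id))) ∘ f)            ≡⟨ pullˡ μ∘T₁ ⟩
      (∇ ∘ ((id ⊕ f †) ∘ (η ⊕ id))) * ∘ f                   ≡⟨ cong (λ z → z * ∘ f) ∇∘⟨id⊕f†⟩∘⟨η⊕id⟩ ⟩
      [ η , f † ] * ∘ f                                     ∎
      where
      ∇∘⟨id⊕f†⟩∘⟨η⊕id⟩ : ∇ ∘ ((id ⊕ f †) ∘ (η ⊕ id)) ≡ [ η , f † ]
      ∇∘⟨id⊕f†⟩∘⟨η⊕id⟩ = trans (cong (∇ ∘_) ⊕∘⊕) (trans ∇∘⊕ (cong₂ [_,_] identityˡ identityʳ))

    uniformity : ∀ {X Y Z} (f : Hom X (T (Y + X))) (g : Hom Z (T (Y + Z)))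
                 (h : Hom Z X) → f ∘ h ≡ T₁ (id ⊕ h) ∘ g → f † ∘ h ≡ g †
    uniformity f g h p = JFree.functoriality _ _ _ h (begin
      (T₁ (η ⊕ id) ∘ f) ∘ h            ≡⟨ trans assoc (cong (T₁ (η ⊕ id) ∘_) p) ⟩
      T₁ (η ⊕ id) ∘ (T₁ (id ⊕ h) ∘ g)  ≡⟨ T₁-∘-∘ ⟩
      T₁ ((η ⊕ id) ∘ (id ⊕ h)) ∘ g     ≡⟨ cong (λ z → T₁ z ∘ g) ⊕-interchange ⟩
      T₁ ((id ⊕ h) ∘ (η ⊕ id)) ∘ g     ≡⟨ sym T₁-∘-∘ ⟩
      T₁ (id ⊕ h) ∘ (T₁ (η ⊕ id) ∘ g)  ∎)

    -- g* ∘ f† is the iterate of a loop that first runs f and then, on exit,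
    -- the non-iterating loop T(inl ∘ η) ∘ g.
    naturality : ∀ {X Y Z} (f : Hom X (T (Y + X))) (g : Hom Y (T Z)) →
                 g * ∘ f † ≡ ([ T₁ inl ∘ g , η ∘ inr ] * ∘ f) †
    naturality {X} {Y} {Z} f g = begin
      g * ∘ f †                          ≡⟨ *∘† g f ⟩
      free‡ Z (T₁ (g ⊕ id) ∘ f)          ≡⟨ cong (λ z → free‡ Z (T₁ (z ⊕ id) ∘ f))
                                                 (sym ‡-T₁⟨inl∘η⟩) ⟩
      free‡ Z (T₁ (free‡ Z g' ⊕ id) ∘ f) ≡⟨ sym (JFree.compositionality Z g' f) ⟩
      free‡ Z (g' ■ f) ∘ inr             ≡⟨ JFree.functoriality Z _ (g' ■ f) inr
                                                 (trans loop (sym exit)) ⟩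
      ([ T₁ inl ∘ g , η ∘ inr ] * ∘ f) †  ∎
      where
      g' : Hom Y (T (T Z + Y))
      g' = T₁ (inl ∘ η) ∘ g

      T₁⟨id⊕inl⟩∘g' : T₁ (id ⊕ inl {B = X}) ∘ g' ≡ T₁ (inl ∘ η) ∘ g
      T₁⟨id⊕inl⟩∘g' =
        trans T₁-∘-∘ (cong (λ z → T₁ z ∘ g) (trans (pullˡ inl-β) (cong (_∘ η) identityʳ)))

      loop : (g' ■ f) ∘ inr ≡ [ T₁ (inl ∘ η) ∘ g , η ∘ inr ∘ inr ] * ∘ f
      loop = trans (cong (_∘ inr) (■≡feedback g' f))
                   (trans (feedback∘inr g' f)
                          (cong (λ z → [ z , η ∘ inr ∘ inr ] * ∘ f) T₁⟨id⊕inl⟩∘g'))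

      exit : T₁ (id ⊕ inr) ∘ (T₁ (η ⊕ id) ∘ ([ T₁ inl ∘ g , η ∘ inr ] * ∘ f))
             ≡ [ T₁ (inl ∘ η) ∘ g , η ∘ inr ∘ inr ] * ∘ f
      exit = begin
        T₁ (id ⊕ inr) ∘ (T₁ (η ⊕ id) ∘ ([ T₁ inl ∘ g , η ∘ inr ] * ∘ f))
          ≡⟨ T₁-∘-∘ ⟩
        T₁ ((id ⊕ inr) ∘ (η ⊕ id)) ∘ ([ T₁ inl ∘ g , η ∘ inr ] * ∘ f)
          ≡⟨ cong (λ z → T₁ z ∘ ([ T₁ inl ∘ g , η ∘ inr ] * ∘ f))
                  (trans ⊕∘⊕ (cong₂ _⊕_ identityˡ identityʳ)) ⟩
        T₁ (η ⊕ inr) ∘ ([ T₁ inl ∘ g , η ∘ inr ] * ∘ f)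
          ≡⟨ pullˡ T₁∘* ⟩
        (T₁ (η ⊕ inr) ∘ [ T₁ inl ∘ g , η ∘ inr ]) * ∘ f
          ≡⟨ cong (λ z → z * ∘ f) (trans ∘-[] (cong₂ [_,_]
               (trans T₁-∘-∘ (cong (λ z → T₁ z ∘ g) inl-β))
               (trans T₁∘η (cong (η ∘_) inr-β)))) ⟩
        [ T₁ (inl ∘ η) ∘ g , η ∘ inr ∘ inr ] * ∘ f
          ∎

    compositionality : ∀ {X Y Z} (g : Hom X (T (Y + X))) (f : Hom Y (T (Z + Y))) →
                       feedback f g † ∘ inr ≡ (f †) * ∘ g †
    compositionality {X} {Y} {Z} g f = begin
      free‡ Z (T₁ (η ⊕ id) ∘ feedback f g) ∘ inr ≡⟨ cong (λ z → free‡ Z z ∘ inr)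
                                                      (trans η-feedback (sym (■≡feedback f' g))) ⟩
      free‡ Z (f' ■ g) ∘ inr                     ≡⟨ JFree.compositionality Z f' g ⟩
      free‡ Z (T₁ (f † ⊕ id) ∘ g)                ≡⟨ sym (*∘† (f †) g) ⟩
      (f †) * ∘ g †                              ∎
      where
      f' : Hom Y (T (T Z + Y))
      f' = T₁ (η ⊕ id) ∘ f

      η-feedback : T₁ (η ⊕ id) ∘ feedback f g ≡ feedback f' g
      η-feedback = trans (pullˡ T₁∘*) (cong (λ z → z * ∘ [ η ∘ inl , g ])
        (trans ∘-[] (cong₂ [_,_]
          (trans T₁-∘-∘ (trans (cong (λ z → T₁ z ∘ f) ⊕-interchange) (sym T₁-∘-∘)))
          (trans T₁∘η (cong (η ∘_) (trans (pullˡ inr-β) (cong (_∘ inr) identityʳ)))))))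

    isWeakCompleteElgot : IsWeakCompleteElgot _†
    isWeakCompleteElgot = record
      { fixpoint = fixpoint ; naturality = naturality
      ; uniformity = uniformity ; compositionality = compositionality }

theorem5p4 : ∀ {o ℓ : Level} (C : Category o ℓ) (cp : FiniteCoproducts C)
    (𝕋 : KleisliTriple C) →
    Setting.StatementI C cp 𝕋 × Setting.StatementII C cp 𝕋
theorem5p4 C cp 𝕋 =
  (λ _† W → FromElgotMonad.emAlg≅elgotSub _† W) ,
  (λ J J-mor → let open FromElgotFunctor J J-mor in
     isWeakCompleteElgot ,
     (λ A B f h → f , J-full A B f h , refl) ,
     (λ _ _ _ _ _ _ g≡h → g≡h))
  where open Theory C cp 𝕋
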